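{- For positive integers $m,n$ with $n>m+1$, $$\sum_{k=1}^n (-1)^{k-1}\left[\begin{matrix}2n\\ n-k\end{matrix}\right]k^{1+2m} = \frac18\sum_{\ell=0}^m (-1)^\ell \left\langle 2n-\tfrac12\right\rangle_{2\ell}\left\{\frac{2n-2\ell-1}{n-\ell-1}\left[\begin{matrix}2n-2\ell\\ n-\ell\end{matrix}\right] + (-1)^{n+\ell}\frac{(1+2n)(1+2\ell)}{n-\ell-1}\left[\begin{matrix}2n-\ell\\ \ell\end{matrix}\right]^{ -1}\right\}\sigma_{m,\ell}\left(n-\tfrac12\right).$$
   Context: Rising factorial: $(x)_0=1$, $(x)_j=x(x+1)\cdots(x+j-1)$; falling factorial: $\langle x\rangle_0=1$, $\langle x\rangle_j=x(x-1)\cdots(x-j+1)$ for positive integers $j$. For integers $0\le j\le N$, $\left[\begin{matrix}N\\ j\end{matrix}\right]=\frac{(\frac12)_N}{(\frac12)_j(\frac12)_{N-j}}$. For nonnegative integers $\ell\le m$ and an indeterminate $y$, $\sigma_{m,\ell}(y)$ denotes the coefficient of $T^{m-\ell}$ in the formal power series $\prod_{j=0}^{\ell} \frac{1}{1-T(y-j)^2}$; equivalently $\sigma_{m,\ell}(y)=\sum_{0\le k_1\le\cdots\le k_{m-\ell}\le \ell}\prod_{i=1}^{m-\ell}(y-k_i)^2$. -}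

module Defs where

open import Data.Nat as ℕ using (ℕ; zero; suc)
open import Data.Integer using (+_)
open import Data.Rational using (ℚ; 0ℚ; 1ℚ; ½; _+_; _*_; _-_; -_; _÷_; _/_; ≢-nonZero)
open import Data.Rational.Properties using (_≟_)
open import Relation.Nullary using (yes; no)

⟦_⟧ : ℕ → ℚ
⟦ n ⟧ = + n / 1

-- total division on ℚ: p ⊘ q = p / q for q ≠ 0 (and 0 when q = 0; this case never
-- arises in the statement, all denominators there are nonzero)
_⊘_ : ℚ → ℚ → ℚ
p ⊘ q with q ≟ 0ℚ
... | yes _ = 0ℚ
... | no q≢0 = _÷_ p q {{≢-nonZero q≢0}}

sgn : ℕ → ℚ
sgn zero = 1ℚ
sgn (suc k) = - sgn k

rising : ℚ → ℕ → ℚ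
rising x zero = 1ℚ
rising x (suc j) = rising x j * (x + ⟦ j ⟧)

falling : ℚ → ℕ → ℚ
falling x zero = 1ℚ
falling x (suc j) = falling x j * (x - ⟦ j ⟧)

-- [N over j] = (1/2)_N / ((1/2)_j (1/2)_{N-j})   (used only for 0 ≤ j ≤ N)
bracket : ℕ → ℕ → ℚ
bracket N j = rising ½ N ⊘ (rising ½ j * rising ½ (N ℕ.∸ j))

-- Σ_{k=lo}^{hi} f k  (empty sum = 0 when hi < lo)
sumFT : ℕ → ℕ → (ℕ → ℚ) → ℚ
sumFT lo hi f = go (suc hi ℕ.∸ lo)
  where
  go : ℕ → ℚ
  go zero = 0ℚ
  go (suc c) = go c + f (lo ℕ.+ c)

-- chain y ℓ r lo = Σ_{lo ≤ k_1 ≤ ... ≤ k_r ≤ ℓ} Π_i (y - k_i)^2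
chain : ℚ → ℕ → ℕ → ℕ → ℚ
chain y ℓ zero lo = 1ℚ
chain y ℓ (suc r) lo = sumFT lo ℓ (λ k → ((y - ⟦ k ⟧) * (y - ⟦ k ⟧)) * chain y ℓ r k)

σ : ℕ → ℕ → ℚ → ℚ
σ m ℓ y = chain y ℓ (m ℕ.∸ ℓ) 0

module Submission where

-- Put y = n − ½ and a_j = (y − j)². Since σ_{m,ℓ}(y) is the complete homogeneous polynomial of
-- degree m − ℓ in a_0, …, a_ℓ, Newton interpolation at these nodes gives
-- x^m = Σ_{ℓ ≤ m} σ_{m,ℓ}(y) Π_{j<ℓ} (x − a_j). At x = k² every factor splits as
-- k² − a_j = −(n − k − ½ − j)(n + k − ½ − j), and the two falling products are absorbed by
-- [2n, n−k] = (½)_{2n} / ((½)_{n−k} (½)_{n+k}): the ℓ-th layer of the left-hand side becomes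
-- (−1)^ℓ (½)_{2n} Σ_k (−1)^{k−1} k / ((½)_{N−k} (½)_{N+k}) with N = n − ℓ, once 1/(½)_d is continued
-- to negative d. This alternating sum telescopes: (N − 1) times its k-th term is H(k+1) − H(k) for
-- H(k) = ½ (−1)^k (k − ½) / ((½)_{N−k} (½)_{N−1+k}), and H(n+1), H(1) give the two terms in the braces.

open import Defs
open import Data.Nat as ℕ using (ℕ; suc; _<_; _∸_; _^_)
open import Data.Rational using (ℚ; ½; _+_; _*_; _-_)
open import Relation.Binary.PropositionalEquality using (_≡_)

open import Algebra.Bundles using (CommutativeRing)
open import Data.Fin using (toℕ; inject₁)
open import Data.Fin.Properties using (toℕ<n; toℕ-inject₁; toℕ-fromℕ)
import Data.Integer as ℤ
import Data.Integer.Properties as ℤ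
open import Data.Maybe using (Maybe; just; nothing)
open import Data.Nat.Coprimality using (1-coprimeTo) renaming (sym to coprime-sym)
import Data.Nat.Properties as ℕ
import Data.Nat.Tactic.RingSolver as ℕ-Solver
open import Data.Rational as ℚ using (0ℚ; 1ℚ; -_; mkℚ; Positive)
import Data.Rational.Properties as ℚ
open import Function using (_∘_)
open import Level using (0ℓ)
open import Relation.Binary.PropositionalEquality using (refl; sym; trans; cong; cong₂; subst; module ≡-Reasoning)
open import Relation.Nullary using (yes; no; contradiction)
open import Tactic.RingSolver using (solve-∀)
open import Tactic.RingSolver.Core.AlmostCommutativeRing using (AlmostCommutativeRing; fromCommutativeRing)

open import Algebra.Properties.Semiring.Sum (CommutativeRing.semiring ℚ.+-*-commutativeRing)
  using (sum; sum-cong-≗; ∑-distrib-+; ∑-comm; *-distribˡ-sum; sum-init-last)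
open import Algebra.Properties.Semiring.Exp (CommutativeRing.semiring ℚ.+-*-commutativeRing)
  using () renaming (_^_ to _^ℚ_)

open ≡-Reasoning

ℚ-ring : AlmostCommutativeRing 0ℓ 0ℓ
ℚ-ring = fromCommutativeRing ℚ.+-*-commutativeRing isZero
  where
  isZero : (x : ℚ) → Maybe (0ℚ ≡ x)
  isZero x with x ℚ.≟ 0ℚ
  ... | yes x≡0 = just (sym x≡0)
  ... | no _    = nothing

⟦⟧≡mkℚ : ∀ n → ⟦ n ⟧ ≡ mkℚ (ℤ.+ n) 0 (coprime-sym (1-coprimeTo n))
⟦⟧≡mkℚ n = ℚ.normalize-coprime (coprime-sym (1-coprimeTo n))

⟦⟧-homo-+ : ∀ m n → ⟦ m ℕ.+ n ⟧ ≡ ⟦ m ⟧ + ⟦ n ⟧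
⟦⟧-homo-+ m n = begin
  ℤ.+ (m ℕ.+ n) ℚ./ 1
    ≡⟨ cong (ℚ._/ 1) (cong₂ ℤ._+_ (sym (ℤ.*-identityʳ (ℤ.+ m))) (sym (ℤ.*-identityʳ (ℤ.+ n)))) ⟩
  (ℤ.+ m ℤ.* ℤ.+ 1 ℤ.+ ℤ.+ n ℤ.* ℤ.+ 1) ℚ./ 1
    ≡⟨ sym (cong₂ _+_ (⟦⟧≡mkℚ m) (⟦⟧≡mkℚ n)) ⟩
  ⟦ m ⟧ + ⟦ n ⟧ ∎

⟦⟧-homo-* : ∀ m n → ⟦ m ℕ.* n ⟧ ≡ ⟦ m ⟧ * ⟦ n ⟧
⟦⟧-homo-* m n = trans (cong (ℚ._/ 1) (ℤ.pos-* m n)) (sym (cong₂ _*_ (⟦⟧≡mkℚ m) (⟦⟧≡mkℚ n)))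

⟦⟧-suc : ∀ n → ⟦ suc n ⟧ ≡ 1ℚ + ⟦ n ⟧
⟦⟧-suc = ⟦⟧-homo-+ 1

⟦1+2j⟧ : ∀ j → ⟦ 1 ℕ.+ 2 ℕ.* j ⟧ ≡ 1ℚ + ⟦ 2 ⟧ * ⟦ j ⟧
⟦1+2j⟧ j = trans (⟦⟧-suc (2 ℕ.* j)) (cong (1ℚ +_) (⟦⟧-homo-* 2 j))

⟦⟧-homo-^ : ∀ m n → ⟦ m ^ n ⟧ ≡ ⟦ m ⟧ ^ℚ n
⟦⟧-homo-^ m ℕ.zero    = refl
⟦⟧-homo-^ m (suc n) = trans (⟦⟧-homo-* m (m ^ n)) (cong (⟦ m ⟧ *_) (⟦⟧-homo-^ m n))

⟦⟧-odd-power : ∀ k m → ⟦ k ^ (1 ℕ.+ 2 ℕ.* m) ⟧ ≡ ⟦ k ⟧ * (⟦ k ⟧ * ⟦ k ⟧) ^ℚ m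
⟦⟧-odd-power k m = begin
  ⟦ k ℕ.* k ^ (2 ℕ.* m) ⟧      ≡⟨ ⟦⟧-homo-* k (k ^ (2 ℕ.* m)) ⟩
  ⟦ k ⟧ * ⟦ k ^ (2 ℕ.* m) ⟧    ≡⟨ cong (λ j → ⟦ k ⟧ * ⟦ j ⟧) k^2m≡[k*k]^m ⟩
  ⟦ k ⟧ * ⟦ (k ℕ.* k) ^ m ⟧    ≡⟨ cong (⟦ k ⟧ *_) (trans (⟦⟧-homo-^ (k ℕ.* k) m) (cong (_^ℚ m) (⟦⟧-homo-* k k))) ⟩
  ⟦ k ⟧ * (⟦ k ⟧ * ⟦ k ⟧) ^ℚ m ∎
  where
  k^2m≡[k*k]^m : k ^ (2 ℕ.* m) ≡ (k ℕ.* k) ^ m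
  k^2m≡[k*k]^m = trans (sym (ℕ.^-*-assoc k 2 m)) (cong (λ j → (k ℕ.* j) ^ m) (ℕ.*-identityʳ k))

⟦⟧-pos : ∀ n → Positive ⟦ suc n ⟧
⟦⟧-pos n = ℚ.normalize-pos (suc n) 1

2n∸[n∸k]≡n+k : ∀ n k → k ℕ.≤ n → 2 ℕ.* n ∸ (n ∸ k) ≡ n ℕ.+ k
2n∸[n∸k]≡n+k n k k≤n = begin
  n ℕ.+ (n ℕ.+ 0) ∸ (n ∸ k)  ≡⟨ cong (λ t → n ℕ.+ t ∸ (n ∸ k)) (ℕ.+-identityʳ n) ⟩
  n ℕ.+ n ∸ (n ∸ k)          ≡⟨ ℕ.+-∸-assoc n (ℕ.m∸n≤m n k) ⟩
  n ℕ.+ (n ∸ (n ∸ k))        ≡⟨ cong (n ℕ.+_) (ℕ.m∸[m∸n]≡n k≤n) ⟩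
  n ℕ.+ k                    ∎

2[ℓ+N]∸2ℓ≡2N : ∀ ℓ N → 2 ℕ.* (ℓ ℕ.+ N) ∸ 2 ℕ.* ℓ ≡ 2 ℕ.* N
2[ℓ+N]∸2ℓ≡2N ℓ N = trans (cong (_∸ 2 ℕ.* ℓ) (ℕ.*-distribˡ-+ 2 ℓ N)) (ℕ.m+n∸m≡n (2 ℕ.* ℓ) (2 ℕ.* N))

2[ℓ+N]∸ℓ≡ℓ+2N : ∀ ℓ N → 2 ℕ.* (ℓ ℕ.+ N) ∸ ℓ ≡ ℓ ℕ.+ 2 ℕ.* N
2[ℓ+N]∸ℓ≡ℓ+2N ℓ N = trans (cong (_∸ ℓ) (regroup ℓ N)) (ℕ.m+n∸m≡n ℓ (ℓ ℕ.+ 2 ℕ.* N))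
  where
  regroup : ∀ ℓ N → 2 ℕ.* (ℓ ℕ.+ N) ≡ ℓ ℕ.+ (ℓ ℕ.+ 2 ℕ.* N)
  regroup = ℕ-Solver.solve-∀

∑ℕ : ℕ → (ℕ → ℚ) → ℚ
∑ℕ n f = sum {n} (f ∘ toℕ)

∑ℕ-cong : ∀ n {f g : ℕ → ℚ} → (∀ i → i < n → f i ≡ g i) → ∑ℕ n f ≡ ∑ℕ n g
∑ℕ-cong n {f} {g} f≡g = sum-cong-≗ {n} {f ∘ toℕ} {g ∘ toℕ} (λ i → f≡g (toℕ i) (toℕ<n i))

∑ℕ-distrib-+ : ∀ n (f g : ℕ → ℚ) → ∑ℕ n (λ i → f i + g i) ≡ ∑ℕ n f + ∑ℕ n g
∑ℕ-distrib-+ n f g = ∑-distrib-+ {n} (f ∘ toℕ) (g ∘ toℕ)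

*-distribˡ-∑ℕ : ∀ n x (f : ℕ → ℚ) → x * ∑ℕ n f ≡ ∑ℕ n (λ i → x * f i)
*-distribˡ-∑ℕ n x f = *-distribˡ-sum {n} x (f ∘ toℕ)

∑ℕ-comm : ∀ m n (f : ℕ → ℕ → ℚ) → ∑ℕ m (λ i → ∑ℕ n (f i)) ≡ ∑ℕ n (λ j → ∑ℕ m (λ i → f i j))
∑ℕ-comm m n f = ∑-comm {m} {n} (λ i j → f (toℕ i) (toℕ j))

∑ℕ-init-last : ∀ n (f : ℕ → ℚ) → ∑ℕ (suc n) f ≡ ∑ℕ n f + f n
∑ℕ-init-last n f =
  trans (sum-init-last {n} (f ∘ toℕ))
        (cong₂ _+_ (sum-cong-≗ {n} {f ∘ toℕ ∘ inject₁} {f ∘ toℕ} (cong f ∘ toℕ-inject₁)) (cong f (toℕ-fromℕ n)))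

∑ℕ-telescope : ∀ n (F : ℕ → ℚ) → ∑ℕ n (λ i → F (suc i) - F i) ≡ F n - F 0
∑ℕ-telescope ℕ.zero    F = sym (ℚ.+-inverseʳ (F 0))
∑ℕ-telescope (suc n) F = trans (cong ((F 1 - F 0) +_) (∑ℕ-telescope n (F ∘ suc))) (cancel (F 0) (F 1) (F (suc n)))
  where
  cancel : ∀ a b c → b - a + (c - b) ≡ c - a
  cancel = solve-∀ ℚ-ring

sumFT-init-last : ∀ lo hi f → lo ℕ.≤ suc hi → sumFT lo (suc hi) f ≡ sumFT lo hi f + f (suc hi)
sumFT-init-last lo hi f lo≤ = trans (unfold lo≤) (cong (λ k → sumFT lo hi f + f k) (ℕ.m+[n∸m]≡n lo≤))
  where
  -- sumFT recurses on the number of terms suc hi ∸ lo; rewriting that count exposes one step.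
  unfold : lo ℕ.≤ suc hi → sumFT lo (suc hi) f ≡ sumFT lo hi f + f (lo ℕ.+ (suc hi ∸ lo))
  unfold lo≤ rewrite ℕ.+-∸-assoc 1 lo≤ = refl

sumFT≡∑ℕ : ∀ lo hi f → sumFT lo hi f ≡ ∑ℕ (suc hi ∸ lo) (λ i → f (lo ℕ.+ i))
sumFT≡∑ℕ ℕ.zero          ℕ.zero f = ℚ.+-comm 0ℚ (f 0)
sumFT≡∑ℕ (suc ℕ.zero)    ℕ.zero f = refl
sumFT≡∑ℕ (suc (suc lo)) ℕ.zero f = refl
sumFT≡∑ℕ lo (suc hi) f with lo ℕ.≤? suc hi
... | no lo≰ rewrite ℕ.m≤n⇒m∸n≡0 (ℕ.≰⇒> lo≰) = refl
... | yes lo≤ = begin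
  sumFT lo (suc hi) f                                 ≡⟨ sumFT-init-last lo hi f lo≤ ⟩
  sumFT lo hi f + f (suc hi)                          ≡⟨ cong₂ _+_ (sumFT≡∑ℕ lo hi f) (cong f (sym (ℕ.m+[n∸m]≡n lo≤))) ⟩
  ∑ℕ (suc hi ∸ lo) g + g (suc hi ∸ lo)                ≡⟨ sym (∑ℕ-init-last (suc hi ∸ lo) g) ⟩
  ∑ℕ (suc (suc hi ∸ lo)) g                            ≡⟨ cong (λ c → ∑ℕ c g) (sym (ℕ.+-∸-assoc 1 lo≤)) ⟩
  ∑ℕ (suc (suc hi) ∸ lo) g                            ∎
  where
  g : ℕ → ℚ
  g i = f (lo ℕ.+ i)

sumFT-from-0 : ∀ hi f → sumFT 0 hi f ≡ ∑ℕ (suc hi) f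
sumFT-from-0 = sumFT≡∑ℕ 0

sumFT-from-1 : ∀ hi f → sumFT 1 hi f ≡ ∑ℕ hi (f ∘ suc)
sumFT-from-1 = sumFT≡∑ℕ 1

sumFT-cong : ∀ lo hi {f g : ℕ → ℚ} → lo ℕ.≤ suc hi → (∀ k → k ℕ.≤ hi → f k ≡ g k) →
             sumFT lo hi f ≡ sumFT lo hi g
sumFT-cong lo hi {f} {g} lo≤ f≡g = begin
  sumFT lo hi f                          ≡⟨ sumFT≡∑ℕ lo hi f ⟩
  ∑ℕ (suc hi ∸ lo) (λ i → f (lo ℕ.+ i))  ≡⟨ ∑ℕ-cong (suc hi ∸ lo) (λ i i< → f≡g (lo ℕ.+ i) (in-range i i<)) ⟩
  ∑ℕ (suc hi ∸ lo) (λ i → g (lo ℕ.+ i))  ≡⟨ sym (sumFT≡∑ℕ lo hi g) ⟩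
  sumFT lo hi g                          ∎
  where
  in-range : ∀ i → i < suc hi ∸ lo → lo ℕ.+ i ℕ.≤ hi
  in-range i i< = ℕ.≤-pred (ℕ.≤-trans (ℕ.≤-reflexive (cong suc (ℕ.+-comm lo i))) (ℕ.m≤o∸n⇒m+n≤o (suc i) lo≤ i<))

sumFT-singleton : ∀ lo f → sumFT lo lo f ≡ f lo
sumFT-singleton lo f = begin
  sumFT lo lo f                          ≡⟨ sumFT≡∑ℕ lo lo f ⟩
  ∑ℕ (suc lo ∸ lo) (λ i → f (lo ℕ.+ i))  ≡⟨ cong (λ c → ∑ℕ c (λ i → f (lo ℕ.+ i))) (ℕ.m+n∸n≡m 1 lo) ⟩
  f (lo ℕ.+ 0) + 0ℚ                      ≡⟨ ℚ.+-identityʳ _ ⟩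
  f (lo ℕ.+ 0)                           ≡⟨ cong f (ℕ.+-identityʳ lo) ⟩
  f lo                                   ∎

sumFT-distrib-+ : ∀ lo hi (f g : ℕ → ℚ) → sumFT lo hi (λ k → f k + g k) ≡ sumFT lo hi f + sumFT lo hi g
sumFT-distrib-+ lo hi f g = begin
  sumFT lo hi (λ k → f k + g k)
    ≡⟨ sumFT≡∑ℕ lo hi _ ⟩
  ∑ℕ c (λ i → f (lo ℕ.+ i) + g (lo ℕ.+ i))
    ≡⟨ ∑ℕ-distrib-+ c (λ i → f (lo ℕ.+ i)) (λ i → g (lo ℕ.+ i)) ⟩
  ∑ℕ c (λ i → f (lo ℕ.+ i)) + ∑ℕ c (λ i → g (lo ℕ.+ i))
    ≡⟨ sym (cong₂ _+_ (sumFT≡∑ℕ lo hi f) (sumFT≡∑ℕ lo hi g)) ⟩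
  sumFT lo hi f + sumFT lo hi g ∎
  where
  c = suc hi ∸ lo

*-distribˡ-sumFT : ∀ lo hi x (f : ℕ → ℚ) → x * sumFT lo hi f ≡ sumFT lo hi (λ k → x * f k)
*-distribˡ-sumFT lo hi x f = begin
  x * sumFT lo hi f                          ≡⟨ cong (x *_) (sumFT≡∑ℕ lo hi f) ⟩
  x * ∑ℕ (suc hi ∸ lo) (λ i → f (lo ℕ.+ i))  ≡⟨ *-distribˡ-∑ℕ (suc hi ∸ lo) x (λ i → f (lo ℕ.+ i)) ⟩
  ∑ℕ (suc hi ∸ lo) (λ i → x * f (lo ℕ.+ i))  ≡⟨ sym (sumFT≡∑ℕ lo hi _) ⟩
  sumFT lo hi (λ k → x * f k)                ∎

*-inverse-solve : ∀ q r x d → q * r ≡ 1ℚ → q * x ≡ d → x ≡ r * d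
*-inverse-solve q r x d qr≡1 qx≡d = begin
  x            ≡⟨ sym (ℚ.*-identityˡ x) ⟩
  1ℚ * x       ≡⟨ cong (_* x) (sym qr≡1) ⟩
  q * r * x    ≡⟨ rearrange q r x ⟩
  r * (q * x)  ≡⟨ cong (r *_) qx≡d ⟩
  r * d        ∎
  where
  rearrange : ∀ q r x → q * r * x ≡ r * (q * x)
  rearrange = solve-∀ ℚ-ring

*-inverse-* : ∀ q r s t → q * r ≡ 1ℚ → s * t ≡ 1ℚ → (q * s) * (r * t) ≡ 1ℚ
*-inverse-* q r s t qr≡1 st≡1 =
  trans (rearrange q r s t) (trans (cong₂ _*_ qr≡1 st≡1) (ℚ.*-identityˡ 1ℚ))
  where
  rearrange : ∀ q r s t → (q * s) * (r * t) ≡ (q * r) * (s * t)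
  rearrange = solve-∀ ℚ-ring

⊘-inverseʳ : ∀ q → .{{Positive q}} → q * (1ℚ ⊘ q) ≡ 1ℚ
⊘-inverseʳ q with q ℚ.≟ 0ℚ
... | yes q≡0 = contradiction (sym q≡0) (ℚ.<⇒≢ (ℚ.positive⁻¹ q))
... | no q≢0  = trans (cong (q *_) (ℚ.*-identityˡ _)) (ℚ.*-inverseʳ q {{ℚ.≢-nonZero q≢0}})

⊘≡*inverse : ∀ p q r → q * r ≡ 1ℚ → p ⊘ q ≡ p * r
⊘≡*inverse p q r qr≡1 with q ℚ.≟ 0ℚ
... | yes q≡0 = contradiction (trans (sym qr≡1) (trans (cong (_* r) q≡0) (ℚ.*-zeroˡ r))) λ ()
... | no q≢0  = cong (p *_) (trans (*-inverse-solve q r _ 1ℚ qr≡1 (ℚ.*-inverseʳ q {{ℚ.≢-nonZero q≢0}})) (ℚ.*-identityʳ r))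

sgn-+ : ∀ a b → sgn (a ℕ.+ b) ≡ sgn a * sgn b
sgn-+ ℕ.zero    b = sym (ℚ.*-identityˡ (sgn b))
sgn-+ (suc a) b = trans (cong -_ (sgn-+ a b)) (ℚ.neg-distribˡ-* (sgn a) (sgn b))

rising½-pos : ∀ j → Positive (rising ½ j)
rising½-pos ℕ.zero    = _
rising½-pos (suc j) =
  ℚ.pos*pos⇒pos (rising ½ j) {{rising½-pos j}} (½ + ⟦ j ⟧) {{ℚ.pos+nonNeg⇒pos ½ ⟦ j ⟧ {{ℚ.normalize-nonNeg j 1}}}}

rising½⁻¹ : ℕ → ℚ
rising½⁻¹ j = 1ℚ ⊘ rising ½ j

rising½-inverseʳ : ∀ j → rising ½ j * rising½⁻¹ j ≡ 1ℚ
rising½-inverseʳ j = ⊘-inverseʳ (rising ½ j) {{rising½-pos j}}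

rising½-inverseˡ : ∀ j → rising½⁻¹ j * rising ½ j ≡ 1ℚ
rising½-inverseˡ j = trans (ℚ.*-comm (rising½⁻¹ j) (rising ½ j)) (rising½-inverseʳ j)

rising½⁻¹-suc : ∀ j → rising½⁻¹ (suc j) * (½ + ⟦ j ⟧) ≡ rising½⁻¹ j
rising½⁻¹-suc j = trans (*-inverse-solve (rising ½ j) (rising½⁻¹ j) _ 1ℚ (rising½-inverseʳ j) unfold) (ℚ.*-identityʳ (rising½⁻¹ j))
  where
  rearrange : ∀ r s t → r * (s * t) ≡ r * t * s
  rearrange = solve-∀ ℚ-ring
  unfold : rising ½ j * (rising½⁻¹ (suc j) * (½ + ⟦ j ⟧)) ≡ 1ℚ
  unfold = trans (rearrange (rising ½ j) _ _) (rising½-inverseʳ (suc j))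

falling-suc : ∀ x t → falling x (suc t) ≡ x * falling (x - 1ℚ) t
falling-suc x ℕ.zero    = step x
  where
  step : ∀ x → 1ℚ * (x - ⟦ 0 ⟧) ≡ x * 1ℚ
  step = solve-∀ ℚ-ring
falling-suc x (suc t) = begin
  falling x (suc t) * (x - ⟦ suc t ⟧)              ≡⟨ cong₂ (λ f s → f * (x - s)) (falling-suc x t) (⟦⟧-suc t) ⟩
  x * falling (x - 1ℚ) t * (x - (1ℚ + ⟦ t ⟧))      ≡⟨ step x (falling (x - 1ℚ) t) ⟦ t ⟧ ⟩
  x * (falling (x - 1ℚ) t * (x - 1ℚ - ⟦ t ⟧))      ∎
  where
  step : ∀ x f t → x * f * (x - (1ℚ + t)) ≡ x * (f * (x - 1ℚ - t))
  step = solve-∀ ℚ-ring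

rising½-falling : ∀ ℓ a → rising ½ (ℓ ℕ.+ a) ≡ rising ½ a * falling (⟦ ℓ ℕ.+ a ⟧ - ½) ℓ
rising½-falling ℕ.zero    a = sym (ℚ.*-identityʳ (rising ½ a))
rising½-falling (suc ℓ) a = begin
  rising ½ (ℓ ℕ.+ a) * (½ + X)                              ≡⟨ cong (_* (½ + X)) (rising½-falling ℓ a) ⟩
  rising ½ a * falling (X - ½) ℓ * (½ + X)                  ≡⟨ cong (λ t → rising ½ a * falling t ℓ * (½ + X)) (shift X) ⟩
  rising ½ a * falling (1ℚ + X - ½ - 1ℚ) ℓ * (½ + X)        ≡⟨ step (rising ½ a) (falling (1ℚ + X - ½ - 1ℚ) ℓ) X ⟩
  rising ½ a * ((1ℚ + X - ½) * falling (1ℚ + X - ½ - 1ℚ) ℓ) ≡⟨ cong (rising ½ a *_) (sym (falling-suc (1ℚ + X - ½) ℓ)) ⟩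
  rising ½ a * falling (1ℚ + X - ½) (suc ℓ)                 ≡⟨ cong (λ t → rising ½ a * falling (t - ½) (suc ℓ)) (sym (⟦⟧-suc (ℓ ℕ.+ a))) ⟩
  rising ½ a * falling (⟦ suc ℓ ℕ.+ a ⟧ - ½) (suc ℓ)        ∎
  where
  X = ⟦ ℓ ℕ.+ a ⟧
  shift : ∀ x → x - ½ ≡ 1ℚ + x - ½ - 1ℚ
  shift = solve-∀ ℚ-ring
  step : ∀ r f x → r * f * (½ + x) ≡ r * ((1ℚ + x - ½) * f)
  step = solve-∀ ℚ-ring

rising½⁻¹-falling : ∀ ℓ a → rising½⁻¹ (ℓ ℕ.+ a) * falling (⟦ ℓ ℕ.+ a ⟧ - ½) ℓ ≡ rising½⁻¹ a
rising½⁻¹-falling ℓ a =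
  trans (*-inverse-solve (rising ½ a) (rising½⁻¹ a) _ 1ℚ (rising½-inverseʳ a) unfold) (ℚ.*-identityʳ (rising½⁻¹ a))
  where
  F = falling (⟦ ℓ ℕ.+ a ⟧ - ½) ℓ
  rearrange : ∀ r s f → r * (s * f) ≡ s * (r * f)
  rearrange = solve-∀ ℚ-ring
  unfold : rising ½ a * (rising½⁻¹ (ℓ ℕ.+ a) * F) ≡ 1ℚ
  unfold = begin
    rising ½ a * (rising½⁻¹ (ℓ ℕ.+ a) * F)  ≡⟨ rearrange (rising ½ a) (rising½⁻¹ (ℓ ℕ.+ a)) F ⟩
    rising½⁻¹ (ℓ ℕ.+ a) * (rising ½ a * F)  ≡⟨ cong (rising½⁻¹ (ℓ ℕ.+ a) *_) (sym (rising½-falling ℓ a)) ⟩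
    rising½⁻¹ (ℓ ℕ.+ a) * rising ½ (ℓ ℕ.+ a) ≡⟨ rising½-inverseˡ (ℓ ℕ.+ a) ⟩
    1ℚ                                      ∎

falling-ratio : ∀ ℓ N → falling (⟦ 2 ℕ.* (ℓ ℕ.+ N) ⟧ - ½) (2 ℕ.* ℓ) * rising ½ (2 ℕ.* N) ≡ rising ½ (2 ℕ.* (ℓ ℕ.+ N))
falling-ratio ℓ N = begin
  falling (⟦ 2 ℕ.* (ℓ ℕ.+ N) ⟧ - ½) (2 ℕ.* ℓ) * rising ½ (2 ℕ.* N)
    ≡⟨ ℚ.*-comm _ (rising ½ (2 ℕ.* N)) ⟩
  rising ½ (2 ℕ.* N) * falling (⟦ 2 ℕ.* (ℓ ℕ.+ N) ⟧ - ½) (2 ℕ.* ℓ)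
    ≡⟨ cong (λ j → rising ½ (2 ℕ.* N) * falling (⟦ j ⟧ - ½) (2 ℕ.* ℓ)) (ℕ.*-distribˡ-+ 2 ℓ N) ⟩
  rising ½ (2 ℕ.* N) * falling (⟦ 2 ℕ.* ℓ ℕ.+ 2 ℕ.* N ⟧ - ½) (2 ℕ.* ℓ)
    ≡⟨ sym (rising½-falling (2 ℕ.* ℓ) (2 ℕ.* N)) ⟩
  rising ½ (2 ℕ.* ℓ ℕ.+ 2 ℕ.* N)
    ≡⟨ cong (rising ½) (sym (ℕ.*-distribˡ-+ 2 ℓ N)) ⟩
  rising ½ (2 ℕ.* (ℓ ℕ.+ N)) ∎

bracket≡ : ∀ N j → bracket N j ≡ rising ½ N * (rising½⁻¹ j * rising½⁻¹ (N ∸ j))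
bracket≡ N j = ⊘≡*inverse (rising ½ N) (rising ½ j * rising ½ (N ∸ j)) (rising½⁻¹ j * rising½⁻¹ (N ∸ j))
  (*-inverse-* (rising ½ j) (rising½⁻¹ j) (rising ½ (N ∸ j)) (rising½⁻¹ (N ∸ j)) (rising½-inverseʳ j) (rising½-inverseʳ (N ∸ j)))

1⊘bracket≡ : ∀ N j → ⟦ 1 ⟧ ⊘ bracket N j ≡ rising½⁻¹ N * (rising ½ j * rising ½ (N ∸ j))
1⊘bracket≡ N j = begin
  ⟦ 1 ⟧ ⊘ bracket N j  ≡⟨ cong (⟦ 1 ⟧ ⊘_) (bracket≡ N j) ⟩
  ⟦ 1 ⟧ ⊘ B            ≡⟨ ⊘≡*inverse ⟦ 1 ⟧ B B⁻¹ BB⁻¹≡1 ⟩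
  ⟦ 1 ⟧ * B⁻¹          ≡⟨ ℚ.*-identityˡ B⁻¹ ⟩
  B⁻¹                  ∎
  where
  r r⁻¹ : ℚ
  r = rising½⁻¹ j * rising½⁻¹ (N ∸ j)
  r⁻¹ = rising ½ j * rising ½ (N ∸ j)
  B = rising ½ N * r
  B⁻¹ = rising½⁻¹ N * r⁻¹
  BB⁻¹≡1 : B * B⁻¹ ≡ 1ℚ
  BB⁻¹≡1 = *-inverse-* (rising ½ N) (rising½⁻¹ N) r r⁻¹ (rising½-inverseʳ N)
             (*-inverse-* (rising½⁻¹ j) (rising ½ j) (rising½⁻¹ (N ∸ j)) (rising ½ (N ∸ j))
                          (rising½-inverseˡ j) (rising½-inverseˡ (N ∸ j)))

bracket-central : ∀ N → bracket (2 ℕ.* N) N ≡ rising ½ (2 ℕ.* N) * (rising½⁻¹ N * rising½⁻¹ N)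
bracket-central N = trans (bracket≡ (2 ℕ.* N) N) (cong (λ j → rising ½ (2 ℕ.* N) * (rising½⁻¹ N * rising½⁻¹ j)) 2N∸N≡N)
  where
  2N∸N≡N : 2 ℕ.* N ∸ N ≡ N
  2N∸N≡N = trans (ℕ.m+n∸m≡n N (N ℕ.+ 0)) (ℕ.+-identityʳ N)

1⊘bracket-shifted : ∀ ℓ N →
  ⟦ 1 ⟧ ⊘ bracket (2 ℕ.* (ℓ ℕ.+ N) ∸ ℓ) ℓ ≡ rising½⁻¹ (ℓ ℕ.+ 2 ℕ.* N) * (rising ½ ℓ * rising ½ (2 ℕ.* N))
1⊘bracket-shifted ℓ N = begin
  ⟦ 1 ⟧ ⊘ bracket (2 ℕ.* (ℓ ℕ.+ N) ∸ ℓ) ℓ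
    ≡⟨ 1⊘bracket≡ (2 ℕ.* (ℓ ℕ.+ N) ∸ ℓ) ℓ ⟩
  rising½⁻¹ (2 ℕ.* (ℓ ℕ.+ N) ∸ ℓ) * (rising ½ ℓ * rising ½ (2 ℕ.* (ℓ ℕ.+ N) ∸ ℓ ∸ ℓ))
    ≡⟨ cong (λ j → rising½⁻¹ j * (rising ½ ℓ * rising ½ (j ∸ ℓ))) (2[ℓ+N]∸ℓ≡ℓ+2N ℓ N) ⟩
  rising½⁻¹ (ℓ ℕ.+ 2 ℕ.* N) * (rising ½ ℓ * rising ½ (ℓ ℕ.+ 2 ℕ.* N ∸ ℓ))
    ≡⟨ cong (λ j → rising½⁻¹ (ℓ ℕ.+ 2 ℕ.* N) * (rising ½ ℓ * rising ½ j)) (ℕ.m+n∸m≡n ℓ (2 ℕ.* N)) ⟩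
  rising½⁻¹ (ℓ ℕ.+ 2 ℕ.* N) * (rising ½ ℓ * rising ½ (2 ℕ.* N)) ∎

-- ρ a b = 1/(½)_{a−b}. For a < b it is the continuation Γ(½)/Γ(a − b + ½) = (−1)^{b−a} (½)_{b−a},
-- which keeps the recurrence ρ-suc valid across a = b.
ρ : ℕ → ℕ → ℚ
ρ a       ℕ.zero    = rising½⁻¹ a
ρ ℕ.zero    (suc b) = sgn (suc b) * rising ½ (suc b)
ρ (suc a) (suc b) = ρ a b

ρ-suc : ∀ a b → ρ a (suc b) ≡ ρ a b * (⟦ a ⟧ - ⟦ b ⟧ - ½)
ρ-suc ℕ.zero    ℕ.zero    = refl
ρ-suc ℕ.zero    (suc b) = step (sgn (suc b)) (rising ½ (suc b)) ⟦ suc b ⟧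
  where
  step : ∀ s r t → (- s) * (r * (½ + t)) ≡ s * r * (⟦ 0 ⟧ - t - ½)
  step = solve-∀ ℚ-ring
ρ-suc (suc a) ℕ.zero    = begin
  rising½⁻¹ a                                   ≡⟨ sym (rising½⁻¹-suc a) ⟩
  rising½⁻¹ (suc a) * (½ + ⟦ a ⟧)               ≡⟨ step (rising½⁻¹ (suc a)) ⟦ a ⟧ ⟩
  rising½⁻¹ (suc a) * (1ℚ + ⟦ a ⟧ - ⟦ 0 ⟧ - ½)  ≡⟨ cong (λ t → rising½⁻¹ (suc a) * (t - ⟦ 0 ⟧ - ½)) (sym (⟦⟧-suc a)) ⟩
  rising½⁻¹ (suc a) * (⟦ suc a ⟧ - ⟦ 0 ⟧ - ½)   ∎
  where
  step : ∀ r t → r * (½ + t) ≡ r * (1ℚ + t - ⟦ 0 ⟧ - ½)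
  step = solve-∀ ℚ-ring
ρ-suc (suc a) (suc b) = begin
  ρ a (suc b)                                      ≡⟨ ρ-suc a b ⟩
  ρ a b * (⟦ a ⟧ - ⟦ b ⟧ - ½)                      ≡⟨ step (ρ a b) ⟦ a ⟧ ⟦ b ⟧ ⟩
  ρ a b * ((1ℚ + ⟦ a ⟧) - (1ℚ + ⟦ b ⟧) - ½)        ≡⟨ cong₂ (λ s t → ρ a b * (s - t - ½)) (sym (⟦⟧-suc a)) (sym (⟦⟧-suc b)) ⟩
  ρ a b * (⟦ suc a ⟧ - ⟦ suc b ⟧ - ½)              ∎
  where
  step : ∀ r s t → r * (s - t - ½) ≡ r * ((1ℚ + s) - (1ℚ + t) - ½)
  step = solve-∀ ℚ-ring

ρ-falling : ∀ a b ℓ → ρ a b * falling (⟦ a ⟧ - ⟦ b ⟧ - ½) ℓ ≡ ρ a (b ℕ.+ ℓ)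
ρ-falling a b ℕ.zero    = trans (ℚ.*-identityʳ (ρ a b)) (cong (ρ a) (sym (ℕ.+-identityʳ b)))
ρ-falling a b (suc ℓ) = begin
  ρ a b * (falling u ℓ * (u - ⟦ ℓ ⟧))         ≡⟨ sym (ℚ.*-assoc (ρ a b) _ _) ⟩
  ρ a b * falling u ℓ * (u - ⟦ ℓ ⟧)           ≡⟨ cong (_* (u - ⟦ ℓ ⟧)) (ρ-falling a b ℓ) ⟩
  ρ a (b ℕ.+ ℓ) * (u - ⟦ ℓ ⟧)                 ≡⟨ step (ρ a (b ℕ.+ ℓ)) ⟦ a ⟧ ⟦ b ⟧ ⟦ ℓ ⟧ ⟩
  ρ a (b ℕ.+ ℓ) * (⟦ a ⟧ - (⟦ b ⟧ + ⟦ ℓ ⟧) - ½) ≡⟨ cong (λ t → ρ a (b ℕ.+ ℓ) * (⟦ a ⟧ - t - ½)) (sym (⟦⟧-homo-+ b ℓ)) ⟩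
  ρ a (b ℕ.+ ℓ) * (⟦ a ⟧ - ⟦ b ℕ.+ ℓ ⟧ - ½)     ≡⟨ sym (ρ-suc a (b ℕ.+ ℓ)) ⟩
  ρ a (suc (b ℕ.+ ℓ))                         ≡⟨ cong (ρ a) (sym (ℕ.+-suc b ℓ)) ⟩
  ρ a (b ℕ.+ suc ℓ)                           ∎
  where
  u = ⟦ a ⟧ - ⟦ b ⟧ - ½
  step : ∀ r s t l → r * ((s - t - ½) - l) ≡ r * (s - (t + l) - ½)
  step = solve-∀ ℚ-ring

ρ-cancel-+ : ∀ ℓ a b → ρ (ℓ ℕ.+ a) (ℓ ℕ.+ b) ≡ ρ a b
ρ-cancel-+ ℕ.zero    a b = refl
ρ-cancel-+ (suc ℓ) a b = ρ-cancel-+ ℓ a b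

ρ-≥ : ∀ {a b} → b ℕ.≤ a → ρ a b ≡ rising½⁻¹ (a ∸ b)
ρ-≥ ℕ.z≤n       = refl
ρ-≥ (ℕ.s≤s b≤a) = ρ-≥ b≤a

ρ-< : ∀ a j → ρ a (a ℕ.+ suc j) ≡ sgn (suc j) * rising ½ (suc j)
ρ-< ℕ.zero    j = refl
ρ-< (suc a) j = ρ-< a j

newtonBasis : (ℕ → ℚ) → ℕ → ℚ → ℚ
newtonBasis a ℕ.zero    x = 1ℚ
newtonBasis a (suc ℓ) x = newtonBasis a ℓ x * (x - a ℓ)

newton-mul-x : ∀ (a : ℕ → ℚ) x m (c c′ : ℕ → ℚ) →
  c′ 0 ≡ a 0 * c 0 → (∀ ℓ → ℓ < m → c′ (suc ℓ) ≡ c ℓ + a (suc ℓ) * c (suc ℓ)) → c′ (suc m) ≡ c m →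
  x * ∑ℕ (suc m) (λ ℓ → c ℓ * newtonBasis a ℓ x) ≡ ∑ℕ (suc (suc m)) (λ ℓ → c′ ℓ * newtonBasis a ℓ x)
newton-mul-x a x m c c′ c′₀ c′-suc c′-last = begin
  x * ∑ℕ (suc m) (λ ℓ → c ℓ * P ℓ)
    ≡⟨ *-distribˡ-∑ℕ (suc m) x (λ ℓ → c ℓ * P ℓ) ⟩
  ∑ℕ (suc m) (λ ℓ → x * (c ℓ * P ℓ))
    ≡⟨ ∑ℕ-cong (suc m) (λ ℓ _ → split x (c ℓ) (P ℓ) (a ℓ)) ⟩
  ∑ℕ (suc m) (λ ℓ → u ℓ + v ℓ)
    ≡⟨ ∑ℕ-distrib-+ (suc m) u v ⟩
  ∑ℕ (suc m) u + (v 0 + ∑ℕ m (v ∘ suc))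
    ≡⟨ cong (_+ (v 0 + ∑ℕ m (v ∘ suc))) (∑ℕ-init-last m u) ⟩
  ∑ℕ m u + u m + (v 0 + ∑ℕ m (v ∘ suc))
    ≡⟨ regroup (∑ℕ m u) (u m) (v 0) (∑ℕ m (v ∘ suc)) ⟩
  v 0 + (∑ℕ m u + ∑ℕ m (v ∘ suc) + u m)
    ≡⟨ cong₂ (λ s t → s + (t + u m)) (cong (_* P 0) (sym c′₀)) (sym (∑ℕ-distrib-+ m u (v ∘ suc))) ⟩
  c′ 0 * P 0 + (∑ℕ m (λ ℓ → u ℓ + v (suc ℓ)) + c m * P (suc m))
    ≡⟨ cong₂ (λ s t → c′ 0 * P 0 + (s + t * P (suc m))) (∑ℕ-cong m u+v′≡w) (sym c′-last) ⟩
  c′ 0 * P 0 + (∑ℕ m (w ∘ suc) + w (suc m))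
    ≡⟨ cong (c′ 0 * P 0 +_) (sym (∑ℕ-init-last m (w ∘ suc))) ⟩
  ∑ℕ (suc (suc m)) w ∎
  where
  P u v w : ℕ → ℚ
  P ℓ = newtonBasis a ℓ x
  u ℓ = c ℓ * P (suc ℓ)
  v ℓ = a ℓ * c ℓ * P ℓ
  w ℓ = c′ ℓ * P ℓ
  split : ∀ x c p a → x * (c * p) ≡ c * (p * (x - a)) + a * c * p
  split = solve-∀ ℚ-ring
  regroup : ∀ s t u v → s + t + (u + v) ≡ u + (s + v + t)
  regroup = solve-∀ ℚ-ring
  collect : ∀ c a c′ p → c * p + a * c′ * p ≡ (c + a * c′) * p
  collect = solve-∀ ℚ-ring
  u+v′≡w : ∀ ℓ → ℓ < m → u ℓ + v (suc ℓ) ≡ w (suc ℓ)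
  u+v′≡w ℓ ℓ<m = trans (collect (c ℓ) (a (suc ℓ)) (c (suc ℓ)) (P (suc ℓ))) (cong (_* P (suc ℓ)) (sym (c′-suc ℓ ℓ<m)))

nodeSq : ℚ → ℕ → ℚ
nodeSq y k = (y - ⟦ k ⟧) * (y - ⟦ k ⟧)

chain-last : ∀ y ℓ r lo → lo ℕ.≤ suc ℓ →
             chain y (suc ℓ) (suc r) lo ≡ chain y ℓ (suc r) lo + nodeSq y (suc ℓ) * chain y (suc ℓ) r lo
chain-last y ℓ ℕ.zero    lo lo≤ = sumFT-init-last lo ℓ _ lo≤
chain-last y ℓ (suc r) lo lo≤ = begin
  chain y (suc ℓ) (suc (suc r)) lo
    ≡⟨ sumFT-init-last lo ℓ _ lo≤ ⟩
  sumFT lo ℓ (λ k → a k * chain y (suc ℓ) (suc r) k) + a′ * chain y (suc ℓ) (suc r) (suc ℓ)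
    ≡⟨ cong₂ _+_ (sumFT-cong lo ℓ lo≤ (λ k k≤ℓ → cong (a k *_) (chain-last y ℓ r k (ℕ.m≤n⇒m≤1+n k≤ℓ))))
                 (cong (a′ *_) (sumFT-singleton (suc ℓ) _)) ⟩
  sumFT lo ℓ (λ k → a k * (chain y ℓ (suc r) k + a′ * chain y (suc ℓ) r k)) + a′ * (a′ * D)
    ≡⟨ cong (_+ a′ * (a′ * D)) (trans (sumFT-cong lo ℓ lo≤ (λ k _ → distrib (a k) a′ _ _)) (sumFT-distrib-+ lo ℓ _ _)) ⟩
  C + sumFT lo ℓ (λ k → a′ * (a k * chain y (suc ℓ) r k)) + a′ * (a′ * D)
    ≡⟨ cong (λ s → C + s + a′ * (a′ * D)) (sym (*-distribˡ-sumFT lo ℓ a′ _)) ⟩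
  C + a′ * S + a′ * (a′ * D)
    ≡⟨ regroup C S D a′ ⟩
  C + a′ * (S + a′ * D)
    ≡⟨ cong (λ s → C + a′ * s) (sym (sumFT-init-last lo ℓ _ lo≤)) ⟩
  C + a′ * chain y (suc ℓ) (suc r) lo ∎
  where
  a = nodeSq y
  a′ = a (suc ℓ)
  C = chain y ℓ (suc (suc r)) lo
  S = sumFT lo ℓ (λ k → a k * chain y (suc ℓ) r k)
  D = chain y (suc ℓ) r (suc ℓ)
  distrib : ∀ x x′ c d → x * (c + x′ * d) ≡ x * c + x′ * (x * d)
  distrib = solve-∀ ℚ-ring
  regroup : ∀ c s d x′ → c + x′ * s + x′ * (x′ * d) ≡ c + x′ * (s + x′ * d)
  regroup = solve-∀ ℚ-ring

σ-diag : ∀ m y → σ m m y ≡ 1ℚ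
σ-diag m y = cong (λ r → chain y m r 0) (ℕ.n∸n≡0 m)

σ-suc-0 : ∀ m y → σ (suc m) 0 y ≡ nodeSq y 0 * σ m 0 y
σ-suc-0 m y = ℚ.+-identityˡ _

σ-suc-suc : ∀ m ℓ y → ℓ < m → σ (suc m) (suc ℓ) y ≡ σ m ℓ y + nodeSq y (suc ℓ) * σ m (suc ℓ) y
σ-suc-suc m ℓ y ℓ<m = begin
  chain y (suc ℓ) (m ∸ ℓ) 0                                       ≡⟨ cong (λ r → chain y (suc ℓ) r 0) m∸ℓ≡1+r ⟩
  chain y (suc ℓ) (suc r) 0                                       ≡⟨ chain-last y ℓ r 0 ℕ.z≤n ⟩
  chain y ℓ (suc r) 0 + nodeSq y (suc ℓ) * chain y (suc ℓ) r 0     ≡⟨ cong (λ r → chain y ℓ r 0 + nodeSq y (suc ℓ) * σ m (suc ℓ) y) (sym m∸ℓ≡1+r) ⟩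
  σ m ℓ y + nodeSq y (suc ℓ) * σ m (suc ℓ) y                      ∎
  where
  r = m ∸ suc ℓ
  m∸ℓ≡1+r : m ∸ ℓ ≡ suc r
  m∸ℓ≡1+r = ℕ.+-∸-assoc 1 ℓ<m

pow-newton : ∀ y m x → x ^ℚ m ≡ ∑ℕ (suc m) (λ ℓ → σ m ℓ y * newtonBasis (nodeSq y) ℓ x)
pow-newton y ℕ.zero    x = refl
pow-newton y (suc m) x =
  trans (cong (x *_) (pow-newton y m x))
        (newton-mul-x (nodeSq y) x m (λ ℓ → σ m ℓ y) (λ ℓ → σ (suc m) ℓ y)
                      (σ-suc-0 m y) (λ ℓ → σ-suc-suc m ℓ y) (trans (σ-diag (suc m) y) (sym (σ-diag m y))))

newtonBasis-squares : ∀ y t ℓ → newtonBasis (nodeSq y) ℓ (t * t) ≡ sgn ℓ * (falling (y - t) ℓ * falling (y + t) ℓ)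
newtonBasis-squares y t ℕ.zero    = refl
newtonBasis-squares y t (suc ℓ) = begin
  newtonBasis (nodeSq y) ℓ (t * t) * (t * t - nodeSq y ℓ)
    ≡⟨ cong (_* (t * t - nodeSq y ℓ)) (newtonBasis-squares y t ℓ) ⟩
  sgn ℓ * (falling (y - t) ℓ * falling (y + t) ℓ) * (t * t - nodeSq y ℓ)
    ≡⟨ factor (sgn ℓ) (falling (y - t) ℓ) (falling (y + t) ℓ) y t ⟦ ℓ ⟧ ⟩
  - sgn ℓ * (falling (y - t) ℓ * (y - t - ⟦ ℓ ⟧) * (falling (y + t) ℓ * (y + t - ⟦ ℓ ⟧))) ∎
  where
  factor : ∀ s p q y t l → s * (p * q) * (t * t - (y - l) * (y - l)) ≡ - s * (p * (y - t - l) * (q * (y + t - l)))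
  factor = solve-∀ ℚ-ring

layer : ℕ → ℕ → ℕ → ℚ
layer n ℓ c = sgn c * bracket (2 ℕ.* n) (n ∸ suc c) * (⟦ suc c ⟧ * newtonBasis (nodeSq (⟦ n ⟧ - ½)) ℓ (⟦ suc c ⟧ * ⟦ suc c ⟧))

summand-expansion : ∀ m n c →
  sgn c * bracket (2 ℕ.* n) (n ∸ suc c) * ⟦ suc c ^ (1 ℕ.+ 2 ℕ.* m) ⟧
  ≡ ∑ℕ (suc m) (λ ℓ → σ m ℓ (⟦ n ⟧ - ½) * layer n ℓ c)
summand-expansion m n c = begin
  s * ⟦ suc c ^ (1 ℕ.+ 2 ℕ.* m) ⟧                    ≡⟨ cong (s *_) (⟦⟧-odd-power (suc c) m) ⟩
  s * (K * (K * K) ^ℚ m)                            ≡⟨ cong (λ t → s * (K * t)) (pow-newton y m (K * K)) ⟩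
  s * (K * ∑ℕ (suc m) (λ ℓ → σ m ℓ y * P ℓ))        ≡⟨ cong (s *_) (*-distribˡ-∑ℕ (suc m) K (λ ℓ → σ m ℓ y * P ℓ)) ⟩
  s * ∑ℕ (suc m) (λ ℓ → K * (σ m ℓ y * P ℓ))        ≡⟨ *-distribˡ-∑ℕ (suc m) s (λ ℓ → K * (σ m ℓ y * P ℓ)) ⟩
  ∑ℕ (suc m) (λ ℓ → s * (K * (σ m ℓ y * P ℓ)))      ≡⟨ ∑ℕ-cong (suc m) (λ ℓ _ → rearrange s K (σ m ℓ y) (P ℓ)) ⟩
  ∑ℕ (suc m) (λ ℓ → σ m ℓ y * layer n ℓ c)          ∎
  where
  s = sgn c * bracket (2 ℕ.* n) (n ∸ suc c)
  K = ⟦ suc c ⟧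
  y = ⟦ n ⟧ - ½
  P : ℕ → ℚ
  P ℓ = newtonBasis (nodeSq y) ℓ (K * K)
  rearrange : ∀ s k σ p → s * (k * (σ * p)) ≡ σ * (s * (k * p))
  rearrange = solve-∀ ℚ-ring

reducedTerm : ℕ → ℕ → ℚ
reducedTerm N c = sgn c * ⟦ suc c ⟧ * ρ N (suc c) * rising½⁻¹ (N ℕ.+ suc c)

layer-reduced : ∀ ℓ N c → c < ℓ ℕ.+ N → layer (ℓ ℕ.+ N) ℓ c ≡ rising ½ (2 ℕ.* (ℓ ℕ.+ N)) * sgn ℓ * reducedTerm N c
layer-reduced ℓ N c c<n = begin
  sgn c * bracket (2 ℕ.* n) (n ∸ k) * (K * newtonBasis (nodeSq y) ℓ (K * K))
    ≡⟨ cong₂ (λ b p → sgn c * b * (K * p)) (bracket≡ (2 ℕ.* n) (n ∸ k)) (newtonBasis-squares y K ℓ) ⟩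
  sgn c * (rising ½ (2 ℕ.* n) * (rising½⁻¹ (n ∸ k) * rising½⁻¹ (2 ℕ.* n ∸ (n ∸ k)))) * (K * (sgn ℓ * (F₋ * F₊)))
    ≡⟨ cong (λ j → sgn c * (rising ½ (2 ℕ.* n) * (rising½⁻¹ (n ∸ k) * rising½⁻¹ j)) * (K * (sgn ℓ * (F₋ * F₊))))
            (2n∸[n∸k]≡n+k n k c<n) ⟩
  sgn c * (rising ½ (2 ℕ.* n) * (rising½⁻¹ (n ∸ k) * rising½⁻¹ (n ℕ.+ k))) * (K * (sgn ℓ * (F₋ * F₊)))
    ≡⟨ regroup (sgn c) (rising ½ (2 ℕ.* n)) (rising½⁻¹ (n ∸ k)) (rising½⁻¹ (n ℕ.+ k)) K (sgn ℓ) F₋ F₊ ⟩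
  rising ½ (2 ℕ.* n) * sgn ℓ * (sgn c * K * (rising½⁻¹ (n ∸ k) * F₋) * (rising½⁻¹ (n ℕ.+ k) * F₊))
    ≡⟨ cong₂ (λ p q → rising ½ (2 ℕ.* n) * sgn ℓ * (sgn c * K * p * q)) lower upper ⟩
  rising ½ (2 ℕ.* n) * sgn ℓ * reducedTerm N c ∎
  where
  n = ℓ ℕ.+ N
  k = suc c
  K = ⟦ k ⟧
  y = ⟦ n ⟧ - ½
  F₋ = falling (y - K) ℓ
  F₊ = falling (y + K) ℓ
  regroup : ∀ s r i j k t p q → s * (r * (i * j)) * (k * (t * (p * q))) ≡ r * t * (s * k * (i * p) * (j * q))
  regroup = solve-∀ ℚ-ring
  swap-½ : ∀ x k → x - ½ - k ≡ x - k - ½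
  swap-½ = solve-∀ ℚ-ring
  move-½ : ∀ x k → x - ½ + k ≡ x + k - ½
  move-½ = solve-∀ ℚ-ring
  lower : rising½⁻¹ (n ∸ k) * F₋ ≡ ρ N k
  lower = begin
    rising½⁻¹ (n ∸ k) * F₋                    ≡⟨ cong₂ _*_ (sym (ρ-≥ c<n)) (cong (λ t → falling t ℓ) (swap-½ ⟦ n ⟧ K)) ⟩
    ρ n k * falling (⟦ n ⟧ - K - ½) ℓ         ≡⟨ ρ-falling n k ℓ ⟩
    ρ n (k ℕ.+ ℓ)                             ≡⟨ cong (ρ n) (ℕ.+-comm k ℓ) ⟩
    ρ (ℓ ℕ.+ N) (ℓ ℕ.+ k)                     ≡⟨ ρ-cancel-+ ℓ N k ⟩
    ρ N k                                     ∎
  upper : rising½⁻¹ (n ℕ.+ k) * F₊ ≡ rising½⁻¹ (N ℕ.+ k)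
  upper = begin
    rising½⁻¹ (n ℕ.+ k) * F₊
      ≡⟨ cong (λ t → rising½⁻¹ (n ℕ.+ k) * falling t ℓ) (trans (move-½ ⟦ n ⟧ K) (cong (_- ½) (sym (⟦⟧-homo-+ n k)))) ⟩
    rising½⁻¹ (n ℕ.+ k) * falling (⟦ n ℕ.+ k ⟧ - ½) ℓ
      ≡⟨ cong (λ j → rising½⁻¹ j * falling (⟦ j ⟧ - ½) ℓ) (ℕ.+-assoc ℓ N k) ⟩
    rising½⁻¹ (ℓ ℕ.+ (N ℕ.+ k)) * falling (⟦ ℓ ℕ.+ (N ℕ.+ k) ⟧ - ½) ℓ
      ≡⟨ rising½⁻¹-falling ℓ (N ℕ.+ k) ⟩
    rising½⁻¹ (N ℕ.+ k) ∎

antidifference : ℕ → ℕ → ℚ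
antidifference d k = ½ * (sgn k * (⟦ k ⟧ - ½) * ρ (suc d) k * rising½⁻¹ (d ℕ.+ k))

antidifference-step : ∀ d c →
  antidifference d (suc (suc c)) - antidifference d (suc c) ≡ ⟦ d ⟧ * reducedTerm (suc d) c
antidifference-step d c = begin
  antidifference d (suc (suc c)) - antidifference d (suc c)
    ≡⟨ cong₂ _-_ later earlier ⟩
  ½ * (- - s * (1ℚ + K - ½) * (X * (1ℚ + D - K - ½)) * Y) - ½ * (- s * (K - ½) * X * (Y * (½ + (D + K))))
    ≡⟨ step s K D X Y ⟩
  D * (s * K * X * Y) ∎
  where
  s = sgn c
  K = ⟦ suc c ⟧
  D = ⟦ d ⟧
  X = ρ (suc d) (suc c)
  Y = rising½⁻¹ (suc d ℕ.+ suc c)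
  later : antidifference d (suc (suc c)) ≡ ½ * (- - s * (1ℚ + K - ½) * (X * (1ℚ + D - K - ½)) * Y)
  later = begin
    ½ * (- - s * (⟦ suc (suc c) ⟧ - ½) * ρ (suc d) (suc (suc c)) * rising½⁻¹ (d ℕ.+ suc (suc c)))
      ≡⟨ cong₂ (λ p q → ½ * (- - s * (⟦ suc (suc c) ⟧ - ½) * p * q))
               (trans (ρ-suc (suc d) (suc c)) (cong (λ t → X * (t - K - ½)) (⟦⟧-suc d)))
               (cong rising½⁻¹ (ℕ.+-suc d (suc c))) ⟩
    ½ * (- - s * (⟦ suc (suc c) ⟧ - ½) * (X * (1ℚ + D - K - ½)) * Y)
      ≡⟨ cong (λ t → ½ * (- - s * (t - ½) * (X * (1ℚ + D - K - ½)) * Y)) (⟦⟧-suc (suc c)) ⟩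
    ½ * (- - s * (1ℚ + K - ½) * (X * (1ℚ + D - K - ½)) * Y) ∎
  earlier : antidifference d (suc c) ≡ ½ * (- s * (K - ½) * X * (Y * (½ + (D + K))))
  earlier = cong (λ t → ½ * (- s * (K - ½) * X * t))
                 (trans (sym (rising½⁻¹-suc (d ℕ.+ suc c))) (cong (λ t → Y * (½ + t)) (⟦⟧-homo-+ d (suc c))))
  step : ∀ s k d x y →
    ½ * (- - s * (1ℚ + k - ½) * (x * (1ℚ + d - k - ½)) * y) - ½ * (- s * (k - ½) * x * (y * (½ + (d + k))))
    ≡ d * (s * k * x * y)
  step = solve-∀ ℚ-ring

∑-reducedTerm : ∀ d n → ⟦ d ⟧ * ∑ℕ n (reducedTerm (suc d)) ≡ antidifference d (suc n) - antidifference d 1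
∑-reducedTerm d n = begin
  ⟦ d ⟧ * ∑ℕ n (reducedTerm (suc d))
    ≡⟨ *-distribˡ-∑ℕ n ⟦ d ⟧ (reducedTerm (suc d)) ⟩
  ∑ℕ n (λ c → ⟦ d ⟧ * reducedTerm (suc d) c)
    ≡⟨ ∑ℕ-cong n (λ c _ → sym (antidifference-step d c)) ⟩
  ∑ℕ n (λ c → antidifference d (suc (suc c)) - antidifference d (suc c))
    ≡⟨ ∑ℕ-telescope n (antidifference d ∘ suc) ⟩
  antidifference d (suc n) - antidifference d 1 ∎

antidifference-1 : ∀ d →
  antidifference d 1 ≡ ½ * (- 1ℚ * (⟦ 1 ⟧ - ½) * (rising½⁻¹ (suc d) * (½ + ⟦ d ⟧)) * rising½⁻¹ (suc d))
antidifference-1 d =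
  cong₂ (λ p q → ½ * (- 1ℚ * (⟦ 1 ⟧ - ½) * p * q)) (sym (rising½⁻¹-suc d)) (cong rising½⁻¹ (ℕ.+-comm d 1))

antidifference-end : ∀ ℓ d → let n = ℓ ℕ.+ suc d in
  antidifference d (suc n)
  ≡ ½ * (- sgn n * (1ℚ + ⟦ n ⟧ - ½) * (- sgn ℓ * (rising ½ ℓ * (½ + ⟦ ℓ ⟧))) * rising½⁻¹ (ℓ ℕ.+ 2 ℕ.* suc d))
antidifference-end ℓ d = begin
  ½ * (- sgn n * (⟦ suc n ⟧ - ½) * ρ (suc d) (suc n) * rising½⁻¹ (d ℕ.+ suc n))
    ≡⟨ cong₂ (λ p q → ½ * (- sgn n * (⟦ suc n ⟧ - ½) * p * rising½⁻¹ q))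
             (trans (cong (ρ (suc d)) (ℕ.+-comm (suc ℓ) (suc d))) (ρ-< (suc d) ℓ))
             (count ℓ d) ⟩
  ½ * (- sgn n * (⟦ suc n ⟧ - ½) * (- sgn ℓ * (rising ½ ℓ * (½ + ⟦ ℓ ⟧))) * rising½⁻¹ (ℓ ℕ.+ 2 ℕ.* suc d))
    ≡⟨ cong (λ t → ½ * (- sgn n * (t - ½) * (- sgn ℓ * (rising ½ ℓ * (½ + ⟦ ℓ ⟧))) * rising½⁻¹ (ℓ ℕ.+ 2 ℕ.* suc d)))
            (⟦⟧-suc n) ⟩
  ½ * (- sgn n * (1ℚ + ⟦ n ⟧ - ½) * (- sgn ℓ * (rising ½ ℓ * (½ + ⟦ ℓ ⟧))) * rising½⁻¹ (ℓ ℕ.+ 2 ℕ.* suc d)) ∎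
  where
  n = ℓ ℕ.+ suc d
  count : ∀ ℓ d → d ℕ.+ suc (ℓ ℕ.+ suc d) ≡ ℓ ℕ.+ 2 ℕ.* suc d
  count = ℕ-Solver.solve-∀

coeff : ℕ → ℕ → ℚ
coeff n ℓ =
  sgn ℓ * falling (⟦ 2 ℕ.* n ⟧ - ½) (2 ℕ.* ℓ)
  * ((⟦ 2 ℕ.* n ∸ 2 ℕ.* ℓ ∸ 1 ⟧ ⊘ ⟦ n ∸ ℓ ∸ 1 ⟧) * bracket (2 ℕ.* n ∸ 2 ℕ.* ℓ) (n ∸ ℓ)
     + sgn (n ℕ.+ ℓ) * ((⟦ 1 ℕ.+ 2 ℕ.* n ⟧ * ⟦ 1 ℕ.+ 2 ℕ.* ℓ ⟧) ⊘ ⟦ n ∸ ℓ ∸ 1 ⟧)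
       * (⟦ 1 ⟧ ⊘ bracket (2 ℕ.* n ∸ ℓ) ℓ))

coeff-closed : ∀ ℓ d V → ⟦ d ⟧ * V ≡ 1ℚ → let n = ℓ ℕ.+ suc d in
  coeff n ℓ
  ≡ sgn ℓ * rising ½ (2 ℕ.* n) * V
    * ((1ℚ + ⟦ 2 ⟧ * ⟦ d ⟧) * (rising½⁻¹ (suc d) * rising½⁻¹ (suc d))
       + sgn n * sgn ℓ * ((1ℚ + ⟦ 2 ⟧ * ⟦ n ⟧) * (1ℚ + ⟦ 2 ⟧ * ⟦ ℓ ⟧)) * (rising ½ ℓ * rising½⁻¹ (ℓ ℕ.+ 2 ℕ.* suc d)))
coeff-closed ℓ d V dV≡1 = begin
  sgn ℓ * F * (X₁ * bracket (2 ℕ.* n ∸ 2 ℕ.* ℓ) (n ∸ ℓ) + sgn (n ℕ.+ ℓ) * X₂ * (⟦ 1 ⟧ ⊘ bracket (2 ℕ.* n ∸ ℓ) ℓ))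
    ≡⟨ cong₂ (λ p q → sgn ℓ * F * (p + q))
             (cong₂ _*_ x₁ (trans (cong₂ bracket (2[ℓ+N]∸2ℓ≡2N ℓ N) (ℕ.m+n∸m≡n ℓ N)) (bracket-central N)))
             (cong₂ _*_ (cong₂ _*_ (sgn-+ n ℓ) x₂) (1⊘bracket-shifted ℓ N)) ⟩
  sgn ℓ * F * (c₁ * V * (R * (a * a)) + sgn n * sgn ℓ * (c₂ * c₃ * V) * (z * (rising ½ ℓ * R)))
    ≡⟨ regroup (sgn ℓ) F c₁ V R a (sgn n * sgn ℓ) (c₂ * c₃) z (rising ½ ℓ) ⟩
  sgn ℓ * (F * R) * V * (c₁ * (a * a) + sgn n * sgn ℓ * (c₂ * c₃) * (rising ½ ℓ * z))
    ≡⟨ cong (λ t → sgn ℓ * t * V * (c₁ * (a * a) + sgn n * sgn ℓ * (c₂ * c₃) * (rising ½ ℓ * z))) (falling-ratio ℓ N) ⟩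
  sgn ℓ * rising ½ (2 ℕ.* n) * V * (c₁ * (a * a) + sgn n * sgn ℓ * (c₂ * c₃) * (rising ½ ℓ * z)) ∎
  where
  N = suc d
  n = ℓ ℕ.+ N
  F = falling (⟦ 2 ℕ.* n ⟧ - ½) (2 ℕ.* ℓ)
  X₁ = ⟦ 2 ℕ.* n ∸ 2 ℕ.* ℓ ∸ 1 ⟧ ⊘ ⟦ n ∸ ℓ ∸ 1 ⟧
  X₂ = (⟦ 1 ℕ.+ 2 ℕ.* n ⟧ * ⟦ 1 ℕ.+ 2 ℕ.* ℓ ⟧) ⊘ ⟦ n ∸ ℓ ∸ 1 ⟧
  R = rising ½ (2 ℕ.* N)
  a = rising½⁻¹ N
  z = rising½⁻¹ (ℓ ℕ.+ 2 ℕ.* N)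
  c₁ = 1ℚ + ⟦ 2 ⟧ * ⟦ d ⟧
  c₂ = 1ℚ + ⟦ 2 ⟧ * ⟦ n ⟧
  c₃ = 1ℚ + ⟦ 2 ⟧ * ⟦ ℓ ⟧
  ⊘n∸ℓ∸1 : ∀ p → p ⊘ ⟦ n ∸ ℓ ∸ 1 ⟧ ≡ p * V
  ⊘n∸ℓ∸1 p = trans (cong (λ j → p ⊘ ⟦ j ∸ 1 ⟧) (ℕ.m+n∸m≡n ℓ N)) (⊘≡*inverse p ⟦ d ⟧ V dV≡1)
  x₁ : X₁ ≡ c₁ * V
  x₁ = begin
    X₁                      ≡⟨ cong (λ j → ⟦ j ∸ 1 ⟧ ⊘ ⟦ n ∸ ℓ ∸ 1 ⟧) (2[ℓ+N]∸2ℓ≡2N ℓ N) ⟩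
    ⟦ 2 ℕ.* N ∸ 1 ⟧ ⊘ ⟦ n ∸ ℓ ∸ 1 ⟧ ≡⟨ ⊘n∸ℓ∸1 ⟦ 2 ℕ.* N ∸ 1 ⟧ ⟩
    ⟦ 2 ℕ.* N ∸ 1 ⟧ * V     ≡⟨ cong (λ j → ⟦ j ⟧ * V) (ℕ.+-suc d (d ℕ.+ 0)) ⟩
    ⟦ 1 ℕ.+ 2 ℕ.* d ⟧ * V   ≡⟨ cong (_* V) (⟦1+2j⟧ d) ⟩
    c₁ * V                  ∎
  x₂ : X₂ ≡ c₂ * c₃ * V
  x₂ = trans (⊘n∸ℓ∸1 (⟦ 1 ℕ.+ 2 ℕ.* n ⟧ * ⟦ 1 ℕ.+ 2 ℕ.* ℓ ⟧)) (cong (_* V) (cong₂ _*_ (⟦1+2j⟧ n) (⟦1+2j⟧ ℓ)))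
  regroup : ∀ s f c₁ v r a t c z b →
    s * f * (c₁ * v * (r * (a * a)) + t * (c * v) * (z * (b * r))) ≡ s * (f * r) * v * (c₁ * (a * a) + t * c * (b * z))
  regroup = solve-∀ ℚ-ring

∑-layer : ∀ ℓ M → let d = suc M ; n = ℓ ℕ.+ suc d in
  ∑ℕ n (layer n ℓ) ≡ (⟦ 1 ⟧ ⊘ ⟦ 8 ⟧) * coeff n ℓ
∑-layer ℓ M = begin
  ∑ℕ n (layer n ℓ)
    ≡⟨ ∑ℕ-cong n (layer-reduced ℓ N) ⟩
  ∑ℕ n (λ c → u * sgn ℓ * reducedTerm N c)
    ≡⟨ sym (*-distribˡ-∑ℕ n (u * sgn ℓ) (reducedTerm N)) ⟩
  u * sgn ℓ * ∑ℕ n (reducedTerm N)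
    ≡⟨ cong (u * sgn ℓ *_) (*-inverse-solve ⟦ d ⟧ V _ _ dV≡1 (∑-reducedTerm d n)) ⟩
  u * sgn ℓ * (V * (antidifference d (suc n) - antidifference d 1))
    ≡⟨ cong₂ (λ p q → u * sgn ℓ * (V * (p - q))) (antidifference-end ℓ d) (antidifference-1 d) ⟩
  u * sgn ℓ * (V * (½ * (- sgn n * (1ℚ + ⟦ n ⟧ - ½) * (- sgn ℓ * (rising ½ ℓ * (½ + ⟦ ℓ ⟧))) * z)
                    - ½ * (- 1ℚ * (⟦ 1 ⟧ - ½) * (a * (½ + ⟦ d ⟧)) * a)))
    ≡⟨ identity u (sgn ℓ) V (sgn n) ⟦ n ⟧ ⟦ ℓ ⟧ ⟦ d ⟧ a (rising ½ ℓ) z ⟩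
  ½ * ½ * ½ * (sgn ℓ * u * V * ((1ℚ + ⟦ 2 ⟧ * ⟦ d ⟧) * (a * a)
                                + sgn n * sgn ℓ * ((1ℚ + ⟦ 2 ⟧ * ⟦ n ⟧) * (1ℚ + ⟦ 2 ⟧ * ⟦ ℓ ⟧)) * (rising ½ ℓ * z)))
    ≡⟨ cong (½ * ½ * ½ *_) (sym (coeff-closed ℓ d V dV≡1)) ⟩
  ½ * ½ * ½ * coeff n ℓ
    ≡⟨⟩
  (⟦ 1 ⟧ ⊘ ⟦ 8 ⟧) * coeff n ℓ ∎
  where
  d = suc M
  N = suc d
  n = ℓ ℕ.+ N
  u = rising ½ (2 ℕ.* n)
  V = 1ℚ ⊘ ⟦ d ⟧
  a = rising½⁻¹ N
  z = rising½⁻¹ (ℓ ℕ.+ 2 ℕ.* N)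
  dV≡1 : ⟦ d ⟧ * V ≡ 1ℚ
  dV≡1 = ⊘-inverseʳ ⟦ d ⟧ {{⟦⟧-pos M}}
  identity : ∀ u s V t n l d a b z →
    u * s * (V * (½ * (- t * (1ℚ + n - ½) * (- s * (b * (½ + l))) * z) - ½ * (- 1ℚ * (⟦ 1 ⟧ - ½) * (a * (½ + d)) * a)))
    ≡ ½ * ½ * ½ * (s * u * V * ((1ℚ + ⟦ 2 ⟧ * d) * (a * a) + t * s * ((1ℚ + ⟦ 2 ⟧ * n) * (1ℚ + ⟦ 2 ⟧ * l)) * (b * z)))
  identity = solve-∀ ℚ-ring

∑-layer-≤ : ∀ n ℓ → ℓ ℕ.+ 2 ℕ.≤ n → ∑ℕ n (layer n ℓ) ≡ (⟦ 1 ⟧ ⊘ ⟦ 8 ⟧) * coeff n ℓ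
∑-layer-≤ n ℓ ℓ+2≤n = subst (λ n → ∑ℕ n (layer n ℓ) ≡ (⟦ 1 ⟧ ⊘ ⟦ 8 ⟧) * coeff n ℓ) n≡ (∑-layer ℓ (n ∸ (ℓ ℕ.+ 2)))
  where
  n≡ : ℓ ℕ.+ suc (suc (n ∸ (ℓ ℕ.+ 2))) ≡ n
  n≡ = trans (sym (ℕ.+-assoc ℓ 2 _)) (ℕ.m+[n∸m]≡n ℓ+2≤n)

theorem12 : (m n : ℕ) → 1 ℕ.≤ m → suc m < n →
    sumFT 1 n (λ k → sgn (k ∸ 1) * bracket (2 ℕ.* n) (n ∸ k) * ⟦ k ^ (1 ℕ.+ 2 ℕ.* m) ⟧)
    ≡ (⟦ 1 ⟧ ⊘ ⟦ 8 ⟧) * sumFT 0 m (λ ℓ →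
        sgn ℓ * falling (⟦ 2 ℕ.* n ⟧ - ½) (2 ℕ.* ℓ)
        * ((⟦ 2 ℕ.* n ∸ 2 ℕ.* ℓ ∸ 1 ⟧ ⊘ ⟦ n ∸ ℓ ∸ 1 ⟧) * bracket (2 ℕ.* n ∸ 2 ℕ.* ℓ) (n ∸ ℓ)
           + sgn (n ℕ.+ ℓ) * ((⟦ 1 ℕ.+ 2 ℕ.* n ⟧ * ⟦ 1 ℕ.+ 2 ℕ.* ℓ ⟧) ⊘ ⟦ n ∸ ℓ ∸ 1 ⟧)
             * (⟦ 1 ⟧ ⊘ bracket (2 ℕ.* n ∸ ℓ) ℓ))
        * σ m ℓ (⟦ n ⟧ - ½))
theorem12 m n _ 1+m<n = begin
  sumFT 1 n (λ k → sgn (k ∸ 1) * bracket (2 ℕ.* n) (n ∸ k) * ⟦ k ^ (1 ℕ.+ 2 ℕ.* m) ⟧)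
    ≡⟨ sumFT-from-1 n _ ⟩
  ∑ℕ n (λ c → sgn c * bracket (2 ℕ.* n) (n ∸ suc c) * ⟦ suc c ^ (1 ℕ.+ 2 ℕ.* m) ⟧)
    ≡⟨ ∑ℕ-cong n (λ c _ → summand-expansion m n c) ⟩
  ∑ℕ n (λ c → ∑ℕ (suc m) (λ ℓ → σ̂ ℓ * layer n ℓ c))
    ≡⟨ ∑ℕ-comm n (suc m) (λ c ℓ → σ̂ ℓ * layer n ℓ c) ⟩
  ∑ℕ (suc m) (λ ℓ → ∑ℕ n (λ c → σ̂ ℓ * layer n ℓ c))
    ≡⟨ ∑ℕ-cong (suc m) (λ ℓ ℓ<1+m → trans (sym (*-distribˡ-∑ℕ n (σ̂ ℓ) (layer n ℓ)))
                                          (cong (σ̂ ℓ *_) (∑-layer-≤ n ℓ (ℓ+2≤n ℓ<1+m)))) ⟩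
  ∑ℕ (suc m) (λ ℓ → σ̂ ℓ * (κ * coeff n ℓ))
    ≡⟨ ∑ℕ-cong (suc m) (λ ℓ _ → rearrange (σ̂ ℓ) κ (coeff n ℓ)) ⟩
  ∑ℕ (suc m) (λ ℓ → κ * (coeff n ℓ * σ̂ ℓ))
    ≡⟨ sym (*-distribˡ-∑ℕ (suc m) κ (λ ℓ → coeff n ℓ * σ̂ ℓ)) ⟩
  κ * ∑ℕ (suc m) (λ ℓ → coeff n ℓ * σ̂ ℓ)
    ≡⟨ cong (κ *_) (sym (sumFT-from-0 m _)) ⟩
  κ * sumFT 0 m (λ ℓ → coeff n ℓ * σ̂ ℓ) ∎
  where
  κ = ⟦ 1 ⟧ ⊘ ⟦ 8 ⟧
  σ̂ : ℕ → ℚ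
  σ̂ ℓ = σ m ℓ (⟦ n ⟧ - ½)
  ℓ+2≤n : ∀ {ℓ} → ℓ < suc m → ℓ ℕ.+ 2 ℕ.≤ n
  ℓ+2≤n ℓ<1+m = ℕ.≤-trans (ℕ.+-monoˡ-≤ 2 (ℕ.≤-pred ℓ<1+m)) (ℕ.≤-trans (ℕ.≤-reflexive (ℕ.+-comm m 2)) 1+m<n)
  rearrange : ∀ s k c → s * (k * c) ≡ k * (c * s)
  rearrange = solve-∀ ℚ-ring
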